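{- There exist infinitely many pairs of trees $(T, T')$ such that $T$ and $T'$ have the same number $n$ of vertices, the same number of leaves, and the same number of branchpoints, where (as $n$ grows) $T$ has exponentially many minimal zero forcing sets and $T'$ has polynomially many minimal zero forcing sets.
   Context: All graphs are finite, simple and undirected. A leaf is a vertex of degree 1; a branchpoint of a tree is a vertex of degree at least 3. Given a set $S$ of initially blue vertices (all others white), the zero forcing color change rule says that a blue vertex with exactly one white neighbor causes that neighbor to become blue. $S$ is a zero forcing set if repeatedly applying this rule eventually makes every vertex blue. A minimal zero forcing set is a zero forcing set containing no other zero forcing set as a proper subset. -}

module Defs where

open import Data.Bool using (Bool; true; false; if_then_else_)
open import Data.Nat using (ℕ; zero; suc; _≤_; _+_)
open import Data.Fin using (Fin)
open import Data.Fin.Subset using (Subset; _∈_; _⊂_)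
open import Data.List using (List; []; _∷_; _++_; [_]; length; map; allFin)
open import Data.Nat.ListAction using (sum)
open import Data.Unit using (⊤)
open import Data.List.Relation.Unary.Unique.Propositional using (Unique)
open import Data.Product using (Σ; _×_; ∃)
open import Relation.Binary.PropositionalEquality using (_≡_; _≢_)
open import Relation.Nullary using (¬_)

record Graph (n : ℕ) : Set where
  field
    adj   : Fin n → Fin n → Bool
    sym   : ∀ u v → adj u v ≡ adj v u
    irrefl : ∀ v → adj v v ≡ false
open Graph public

Adj : ∀ {n} → Graph n → Fin n → Fin n → Set
Adj G u v = adj G u v ≡ true

data Reachable {n} (G : Graph n) : Fin n → Fin n → Set where
  here : ∀ {v} → Reachable G v v
  step : ∀ {u w v} → Adj G u w → Reachable G w v → Reachable G u v

Connected : ∀ {n} → Graph n → Set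
Connected G = ∀ u v → Reachable G u v

Chain : ∀ {n} → Graph n → List (Fin n) → Set
Chain G []            = ⊤
Chain G (x ∷ [])      = ⊤
Chain G (x ∷ y ∷ xs)  = Adj G x y × Chain G (y ∷ xs)

HasCycle : ∀ {n} → Graph n → Set
HasCycle {n} G = Σ (Fin n) λ x → Σ (List (Fin n)) λ ys →
  (2 ≤ length ys) × Unique (x ∷ ys) × Chain G (x ∷ ys ++ [ x ])

IsTree : ∀ {n} → Graph n → Set
IsTree G = Connected G × ¬ HasCycle G

degree : ∀ {n} → Graph n → Fin n → ℕ
degree {n} G v = sum (map (λ w → if adj G v w then 1 else 0) (allFin n))

countV : ∀ {n} → (Fin n → Bool) → ℕ
countV {n} p = sum (map (λ v → if p v then 1 else 0) (allFin n))

isLeafB : ∀ {n} → Graph n → Fin n → Bool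
isLeafB G v with degree G v
... | 1 = true
... | _ = false

isBranchB : ∀ {n} → Graph n → Fin n → Bool
isBranchB G v with degree G v
... | suc (suc (suc _)) = true
... | _ = false

numLeaves : ∀ {n} → Graph n → ℕ
numLeaves G = countV (isLeafB G)

numBranchpoints : ∀ {n} → Graph n → ℕ
numBranchpoints G = countV (isBranchB G)

-- Vertices that eventually become blue starting from the blue set S under the
-- zero forcing color change rule: u (blue) forces its neighbour v once all
-- other neighbours of u are blue.
data Blue {n} (G : Graph n) (S : Subset n) : Fin n → Set where
  initial : ∀ {v} → v ∈ S → Blue G S v
  force   : ∀ {u v} → Blue G S u → Adj G u v →
            (∀ w → Adj G u w → w ≢ v → Blue G S w) → Blue G S v

IsZeroForcingSet : ∀ {n} → Graph n → Subset n → Set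
IsZeroForcingSet G S = ∀ v → Blue G S v

IsMinimalZFS : ∀ {n} → Graph n → Subset n → Set
IsMinimalZFS G S = IsZeroForcingSet G S × (∀ S′ → S′ ⊂ S → ¬ IsZeroForcingSet G S′)

module Submission where

-- Both trees have n = 2k + 1 vertices and, vertex by vertex, the same degrees: each is given by a
-- parent function, and every vertex has the same number of children in both.  In the spider with
-- k legs of length two, one vertex on each of k − 1 legs, a tip among them, is a minimal zero
-- forcing set: the tip's leg forces the centre, which then forces into the remaining leg, while
-- two white legs form a fort.  This gives 2^(k−2) ≥ (9/8)^n minimal sets once k ≥ 4.  In the
-- broom (a path with k − 1 extra leaves at one end), a zero forcing set contains all leaves but
-- at most one (two white leaves form a fort) and a seed for the path, namely its first or last
-- vertex or two consecutive vertices (otherwise the missing leaf and the white path vertices form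
-- a fort).  So a minimal one is determined by the missing leaf and at most two path vertices, and
-- there are at most n³ of them.

open import Defs hiding (sym)
open import Data.Bool using (Bool; true; false; if_then_else_; _∨_)
import Data.Bool.Properties as Bool
open import Data.Bool.Properties using (¬-not)
open import Data.Empty using (⊥; ⊥-elim)
open import Data.Fin using (Fin; toℕ; fromℕ<) renaming (zero to fzero; suc to fsuc)
import Data.Fin.Properties as Fin
open import Data.Fin.Subset using (Subset; _∈_; _∉_; _⊆_; _⊂_)
open import Data.Fin.Subset.Properties using (⊆-antisym; _∈?_)
open import Data.List using (List; []; _∷_; _++_; [_]; length; map; allFin; tabulate; upTo; cartesianProduct; cartesianProductWith; initLast; _∷ʳ′_)
open import Data.List.Membership.Propositional using () renaming (_∈_ to _∈ₗ_)
open import Data.List.Membership.Propositional.Properties using (∈-++⁺ˡ; ∈-++⁺ʳ; ∈-++⁻; ∈-∃++; ∈-map⁺; ∈-map⁻; ∈-upTo⁺; ∈-cartesianProduct⁺)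
open import Data.List.Properties using (length-++; length-map; map-tabulate; map-cong; length-upTo; ++-assoc; ++-identityʳ)
open import Data.List.Relation.Unary.All as All using (All; []; _∷_)
import Data.List.Relation.Unary.All.Properties as All
open import Data.List.Relation.Unary.AllPairs using ([]; _∷_)
open import Data.List.Relation.Unary.Any using (here; there)
open import Data.List.Relation.Unary.Unique.Propositional using (Unique)
import Data.List.Relation.Unary.Unique.Propositional.Properties as Unique
open import Data.Nat
open import Data.Nat.Induction using (<-rec)
open import Data.Nat.ListAction using (sum)
open import Data.Nat.Properties
open import Data.List.Extrema ≤-totalOrder using (argmax; argmax-all; f[⊥]≤f[argmax]; f[xs]≤f[argmax])
open import Data.Nat.Tactic.RingSolver using (solve-∀)
open import Data.Product using (Σ; _×_; _,_; proj₁; proj₂; ∃; ∃₂)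
open import Data.Sum using (_⊎_; inj₁; inj₂; [_,_]′)
open import Data.Unit using (tt)
open import Data.Vec using (Vec; []; _∷_)
import Data.Vec as Vec
import Data.Vec.Properties as Vec
open import Function using (_∘_; mk⇔)
open import Induction.WellFounded using (WfRec)
open import Relation.Binary.PropositionalEquality hiding ([_])
open import Relation.Nullary using (¬_; Dec; yes; no; does; contradiction; ¬?)
open import Relation.Nullary.Decidable using (dec-true; dec-false; does-⇔; _×-dec_; _⊎-dec_)

∑< : ℕ → (ℕ → ℕ) → ℕ
∑< zero    f = 0
∑< (suc n) f = f 0 + ∑< n (f ∘ suc)

sum-allFin : ∀ n (f : ℕ → ℕ) → sum (map (f ∘ toℕ) (allFin n)) ≡ ∑< n f
sum-allFin n f = trans (cong sum (map-tabulate {n = n} (λ i → i) (f ∘ toℕ))) (sum-tabulate n f)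
  where
  sum-tabulate : ∀ n f → sum (tabulate {n = n} (f ∘ toℕ)) ≡ ∑< n f
  sum-tabulate zero    f = refl
  sum-tabulate (suc n) f = cong (f 0 +_) (sum-tabulate n (f ∘ suc))

∑<-cong : ∀ n {f g} → (∀ w → w < n → f w ≡ g w) → ∑< n f ≡ ∑< n g
∑<-cong zero    eq = refl
∑<-cong (suc n) eq = cong₂ _+_ (eq 0 z<s) (∑<-cong n (λ w → eq (suc w) ∘ s<s))

∑<-+ : ∀ n f g → ∑< n (λ w → f w + g w) ≡ ∑< n f + ∑< n g
∑<-+ zero    f g = refl
∑<-+ (suc n) f g = begin
  (f 0 + g 0) + ∑< n (λ w → f (suc w) + g (suc w)) ≡⟨ cong (f 0 + g 0 +_) (∑<-+ n (f ∘ suc) (g ∘ suc)) ⟩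
  (f 0 + g 0) + (F + G)                            ≡⟨ +-assoc (f 0) (g 0) (F + G) ⟩
  f 0 + (g 0 + (F + G))                            ≡⟨ cong (f 0 +_) (x+[y+z]≡y+[x+z] (g 0) F G) ⟩
  f 0 + (F + (g 0 + G))                            ≡⟨ +-assoc (f 0) F (g 0 + G) ⟨
  (f 0 + F) + (g 0 + G)                            ∎
  where
  open ≡-Reasoning
  F = ∑< n (f ∘ suc)
  G = ∑< n (g ∘ suc)
  x+[y+z]≡y+[x+z] : ∀ x y z → x + (y + z) ≡ y + (x + z)
  x+[y+z]≡y+[x+z] x y z = trans (sym (+-assoc x y z)) (trans (cong (_+ z) (+-comm x y)) (+-assoc y x z))

∑<-vanishing : ∀ n {f} → (∀ w → w < n → f w ≡ 0) → ∑< n f ≡ 0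
∑<-vanishing zero    f≡0 = refl
∑<-vanishing (suc n) f≡0 = cong₂ _+_ (f≡0 0 z<s) (∑<-vanishing n (λ w → f≡0 (suc w) ∘ s<s))

∑<-indicator-interval : ∀ n a b {f} → a ≤ b → b ≤ n →
  (∀ w → a ≤ w → w < b → f w ≡ 1) →
  (∀ w → w < n → w < a ⊎ b ≤ w → f w ≡ 0) → ∑< n f ≡ b ∸ a
∑<-indicator-interval n       zero    zero    _         _         _   out = ∑<-vanishing n (λ w w<n → out w w<n (inj₂ z≤n))
∑<-indicator-interval (suc n) zero    (suc b) _         (s≤s b≤n) in' out =
  cong₂ _+_ (in' 0 z≤n z<s)
    (∑<-indicator-interval n zero b z≤n b≤n (λ w _ w<b → in' (suc w) z≤n (s<s w<b))
      (λ { w w<n (inj₂ b≤w) → out (suc w) (s<s w<n) (inj₂ (s≤s b≤w)) }))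
∑<-indicator-interval (suc n) (suc a) (suc b) (s≤s a≤b) (s≤s b≤n) in' out =
  cong₂ _+_ (out 0 z<s (inj₁ z<s))
    (∑<-indicator-interval n a b a≤b b≤n (λ w a≤w w<b → in' (suc w) (s≤s a≤w) (s<s w<b))
      (λ { w w<n (inj₁ w<a) → out (suc w) (s<s w<n) (inj₁ (s<s w<a))
         ; w w<n (inj₂ b≤w) → out (suc w) (s<s w<n) (inj₂ (s≤s b≤w)) }))

∑<-indicator-single : ∀ n a {f} → a < n → f a ≡ 1 → (∀ w → w < n → w ≢ a → f w ≡ 0) → ∑< n f ≡ 1
∑<-indicator-single n a {f} a<n fa≡1 out =
  trans (∑<-indicator-interval n a (suc a) (n≤1+n a) a<n
          (λ w a≤w w<1+a → subst (λ x → f x ≡ 1) (≤-antisym a≤w (s≤s⁻¹ w<1+a)) fa≡1)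
          (λ { w w<n (inj₁ w<a) → out w w<n (<⇒≢ w<a)
             ; w w<n (inj₂ 1+a≤w) → out w w<n (≢-sym (<⇒≢ 1+a≤w)) }))
        (m+n∸n≡m 1 a)

countV-cong : ∀ {n} {p q : Fin n → Bool} → (∀ v → p v ≡ q v) → countV p ≡ countV q
countV-cong {n} p≗q = cong sum (map-cong (λ v → cong (λ b → if b then 1 else 0) (p≗q v)) (allFin n))

numLeaves-cong : ∀ {n} {G H : Graph n} → (∀ v → degree G v ≡ degree H v) → numLeaves G ≡ numLeaves H
numLeaves-cong {G = G} {H} deg≗ = countV-cong leaf≗
  where
  leaf≗ : ∀ v → isLeafB G v ≡ isLeafB H v
  leaf≗ v rewrite deg≗ v = refl

numBranchpoints-cong : ∀ {n} {G H : Graph n} → (∀ v → degree G v ≡ degree H v) → numBranchpoints G ≡ numBranchpoints H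
numBranchpoints-cong {G = G} {H} deg≗ = countV-cong branch≗
  where
  branch≗ : ∀ v → isBranchB G v ≡ isBranchB H v
  branch≗ v rewrite deg≗ v = refl

does⇒witness : ∀ {P : Set} (P? : Dec P) → does P? ≡ true → P
does⇒witness (yes p) _  = p
does⇒witness (no _)  ()

𝟙 : ∀ {P : Set} → Dec P → ℕ
𝟙 P? = if does P? then 1 else 0

𝟙-yes : ∀ {P : Set} (P? : Dec P) → P → 𝟙 P? ≡ 1
𝟙-yes P? p rewrite dec-true P? p = refl

𝟙-no : ∀ {P : Set} (P? : Dec P) → ¬ P → 𝟙 P? ≡ 0
𝟙-no P? ¬p rewrite dec-false P? ¬p = refl

module _ {n} (G : Graph n) where

  Adj-sym : ∀ {u v} → Adj G u v → Adj G v u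
  Adj-sym {u} {v} = trans (Graph.sym G v u)

  Cycle : List (Fin n) → Set
  Cycle []       = ⊥
  Cycle (x ∷ ys) = 2 ≤ length ys × Unique (x ∷ ys) × Chain G (x ∷ ys ++ [ x ])

  Chain-snoc : ∀ xs a b → Chain G (xs ++ [ a ]) → Adj G a b → Chain G ((xs ++ [ a ]) ++ [ b ])
  Chain-snoc []           a b _         a~b = a~b , tt
  Chain-snoc (x ∷ [])     a b (x~a , _) a~b = x~a , a~b , tt
  Chain-snoc (x ∷ y ∷ xs) a b (x~y , c) a~b = x~y , Chain-snoc (y ∷ xs) a b c a~b

  Chain-last : ∀ xs a b → Chain G (xs ++ a ∷ b ∷ []) → Adj G a b
  Chain-last []           a b (a~b , _) = a~b
  Chain-last (x ∷ [])     a b (_ , c)   = Chain-last [] a b c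
  Chain-last (x ∷ y ∷ xs) a b (_ , c)   = Chain-last (y ∷ xs) a b c

  Cycle-rotate₁ : ∀ a xs → Cycle (a ∷ xs) → Cycle (xs ++ [ a ])
  Cycle-rotate₁ a []           (() , _)
  Cycle-rotate₁ a (y ∷ [])     (s≤s () , _)
  Cycle-rotate₁ a (y ∷ z ∷ ys) (len , a∉ ∷ unique , a~y , chain) =
    length-ok , Unique.++⁺ unique ([] ∷ []) disjoint , Chain-snoc (y ∷ z ∷ ys) a y chain a~y
    where
    length-ok : 2 ≤ length (z ∷ ys ++ [ a ])
    length-ok rewrite length-++ ys {[ a ]} | +-comm (length ys) 1 = s≤s (s≤s z≤n)
    disjoint : ∀ {v} → v ∈ₗ y ∷ z ∷ ys × v ∈ₗ [ a ] → ⊥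
    disjoint (v∈ , here refl) = All.lookup a∉ v∈ refl

  Cycle-rotate : ∀ pre x post → Cycle (pre ++ x ∷ post) → Cycle (x ∷ post ++ pre)
  Cycle-rotate []        x post c = subst Cycle (cong (x ∷_) (sym (++-identityʳ post))) c
  Cycle-rotate (a ∷ pre) x post c =
    subst Cycle (cong (x ∷_) (++-assoc post [ a ] pre))
      (Cycle-rotate pre x (post ++ [ a ])
        (subst Cycle (++-assoc pre (x ∷ post) [ a ]) (Cycle-rotate₁ a (pre ++ x ∷ post) c)))

  -- no vertex outside F has exactly one neighbour in F
  IsFort : (Fin n → Set) → Set
  IsFort F = ∀ u v → Adj G u v → F v → F u ⊎ ∃ λ w → Adj G u w × w ≢ v × F w

  fort-stays-white : ∀ {F S} → IsFort F → (∀ v → F v → v ∉ S) → ∀ {v} → Blue G S v → ¬ F v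
  fort-stays-white fort F∩S=∅ (initial v∈S)             Fv = F∩S=∅ _ Fv v∈S
  fort-stays-white fort F∩S=∅ (force {u} {v} Bu u~v others) Fv with fort u v u~v Fv
  ... | inj₁ Fu               = fort-stays-white fort F∩S=∅ Bu Fu
  ... | inj₂ (w , u~w , w≢v , Fw) = fort-stays-white fort F∩S=∅ (others w u~w w≢v) Fw

  minimalZFS-⊇ZFS⇒≡ : ∀ {S C} → IsMinimalZFS G S → IsZeroForcingSet G C → C ⊆ S → S ≡ C
  minimalZFS-⊇ZFS⇒≡ {S} {C} (_ , minimal) C-zfs C⊆S = ⊆-antisym S⊆C C⊆S
    where
    S⊆C : S ⊆ C
    S⊆C {x} x∈S with x ∈? C
    ... | yes x∈C = x∈C
    ... | no  x∉C = ⊥-elim (minimal C (C⊆S , x , x∈S , x∉C) C-zfs)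

module _ {n} {G : Graph n} where

  Reachable-snoc : ∀ {a b c} → Reachable G a b → Adj G b c → Reachable G a c
  Reachable-snoc here       b~c = step b~c here
  Reachable-snoc (step x r) b~c = step x (Reachable-snoc r b~c)

  Reachable-sym : ∀ {a b} → Reachable G a b → Reachable G b a
  Reachable-sym here                 = here
  Reachable-sym (step {u} {w} u~w r) = Reachable-snoc (Reachable-sym r) (Adj-sym G u~w)

  Reachable-trans : ∀ {a b c} → Reachable G a b → Reachable G b c → Reachable G a c
  Reachable-trans here       s = s
  Reachable-trans (step x r) s = step x (Reachable-trans r s)

tab : ∀ {n} → (ℕ → Bool) → Subset n
tab s = Vec.tabulate (s ∘ toℕ)

∈-tab⁺ : ∀ {n} s (v : Fin n) → s (toℕ v) ≡ true → v ∈ tab s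
∈-tab⁺ s v sv = Vec.lookup⇒[]= v _ (trans (Vec.lookup∘tabulate _ v) sv)

∈-tab⁻ : ∀ {n} s (v : Fin n) → v ∈ tab s → s (toℕ v) ≡ true
∈-tab⁻ s v v∈ = trans (sym (Vec.lookup∘tabulate _ v)) (Vec.[]=⇒lookup v∈)

∉-tab : ∀ {n} s (v : Fin n) → s (toℕ v) ≡ false → v ∉ tab s
∉-tab s v sv v∈ with trans (sym sv) (∈-tab⁻ s v v∈)
... | ()

χ : ∀ {n} → Subset n → ℕ → Bool
χ {n} S i with i <? n
... | yes i<n = Vec.lookup S (fromℕ< i<n)
... | no  _   = false

tab-χ : ∀ {n} (S : Subset n) → tab (χ S) ≡ S
tab-χ {n} S = trans (Vec.tabulate-cong χ∘toℕ) (Vec.tabulate∘lookup S)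
  where
  χ∘toℕ : ∀ v → χ S (toℕ v) ≡ Vec.lookup S v
  χ∘toℕ v with toℕ v <? n
  ... | yes v<n = cong (Vec.lookup S) (Fin.fromℕ<-toℕ v v<n)
  ... | no  v≮n = contradiction (Fin.toℕ<n v) v≮n

-- The tree on Fin (suc m), handled through vertex indices: every w > 0 hangs below its parent par w < w.
module ParentTree (m : ℕ) (par : ℕ → ℕ) (par< : ∀ w → 0 < w → par w < w) where

  n : ℕ
  n = suc m

  Child : ℕ → ℕ → Set
  Child a b = 0 < a × par a ≡ b

  child? : ∀ a b → Dec (Child a b)
  child? a b = (0 <? a) ×-dec (par a ≟ b)

  Edge : ℕ → ℕ → Set
  Edge a b = Child a b ⊎ Child b a

  edge? : ∀ a b → Dec (Edge a b)
  edge? a b = child? a b ⊎-dec child? b a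

  Edge-sym : ∀ {a b} → Edge a b → Edge b a
  Edge-sym (inj₁ c) = inj₂ c
  Edge-sym (inj₂ c) = inj₁ c

  Edge-irrefl : ∀ a → ¬ Edge a a
  Edge-irrefl a (inj₁ (a>0 , eq)) = <-irrefl eq (par< a a>0)
  Edge-irrefl a (inj₂ (a>0 , eq)) = <-irrefl eq (par< a a>0)

  Child-asym : ∀ {a b} → Child a b → ¬ Child b a
  Child-asym {a} {b} (a>0 , pa≡b) (b>0 , pb≡a) =
    <-asym (subst (_< a) pa≡b (par< a a>0)) (subst (_< b) pb≡a (par< b b>0))

  tree : Graph n
  tree = record
    { adj    = λ u v → does (edge? (toℕ u) (toℕ v))
    ; sym    = λ u v → does-⇔ (mk⇔ Edge-sym Edge-sym) (edge? (toℕ u) (toℕ v)) (edge? (toℕ v) (toℕ u))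
    ; irrefl = λ v → dec-false (edge? (toℕ v) (toℕ v)) (Edge-irrefl (toℕ v))
    }

  Adj⇒Edge : ∀ {u v} → Adj tree u v → Edge (toℕ u) (toℕ v)
  Adj⇒Edge {u} {v} = does⇒witness (edge? (toℕ u) (toℕ v))

  Edge⇒Adj : ∀ {u v} → Edge (toℕ u) (toℕ v) → Adj tree u v
  Edge⇒Adj {u} {v} = dec-true (edge? (toℕ u) (toℕ v))

  connected : Connected tree
  connected u v = Reachable-trans (reach-root u) (Reachable-sym (reach-root v))
    where
    ReachesRoot : ℕ → Set
    ReachesRoot i = ∀ u → toℕ u ≡ i → Reachable tree u fzero
    climb : ∀ i → WfRec _<_ ReachesRoot i → ReachesRoot i
    climb _ _  fzero    _    = here
    climb _ ih (fsuc u) refl = step (Edge⇒Adj {fsuc u} (inj₁ (z<s , sym toℕ-p))) (ih p<u p toℕ-p)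
      where
      p<u : par (suc (toℕ u)) < suc (toℕ u)
      p<u = par< (suc (toℕ u)) z<s
      p : Fin n
      p = fromℕ< (<-trans p<u (Fin.toℕ<n (fsuc u)))
      toℕ-p : toℕ p ≡ par (suc (toℕ u))
      toℕ-p = Fin.toℕ-fromℕ< _
    reach-root : ∀ u → Reachable tree u fzero
    reach-root u = <-rec ReachesRoot climb (toℕ u) u refl

  smaller-neighbour-is-parent : ∀ {u w} → Adj tree u w → toℕ w < toℕ u → par (toℕ u) ≡ toℕ w
  smaller-neighbour-is-parent {u} {w} u~w w<u with Adj⇒Edge {u} {w} u~w
  ... | inj₁ (_ , pu≡w)   = pu≡w
  ... | inj₂ (w>0 , pw≡u) = contradiction (subst (_< toℕ w) pw≡u (par< (toℕ w) w>0)) (<-asym w<u)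

  -- both cycle neighbours of the largest vertex on a cycle would be its parent
  no-cycle-through-max : ∀ top xs → Cycle tree (top ∷ xs) → All (λ y → toℕ y ≤ toℕ top) xs → ⊥
  no-cycle-through-max top xs cycle below with initLast xs
  no-cycle-through-max top _ (s≤s () , _) below | [] ∷ʳ′ y
  no-cycle-through-max top _ (_ , top∉ ∷ b∉ ∷ _ , top~b , chain) below | (b ∷ q) ∷ʳ′ y =
    All.lookup b∉ y∈ b≡y
    where
    y∈ : y ∈ₗ q ++ [ y ]
    y∈ = ∈-++⁺ʳ q (here refl)
    smaller : ∀ {v} → v ∈ₗ b ∷ q ++ [ y ] → toℕ v < toℕ top
    smaller v∈ = ≤∧≢⇒< (All.lookup below v∈) (λ eq → All.lookup top∉ v∈ (sym (Fin.toℕ-injective eq)))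
    y~top : Adj tree y top
    y~top = Chain-last tree (top ∷ b ∷ q) y top (subst (λ t → Chain tree (top ∷ b ∷ t)) (++-assoc q [ y ] [ top ]) (top~b , chain))
    b≡y : b ≡ y
    b≡y = Fin.toℕ-injective (trans (sym (smaller-neighbour-is-parent top~b (smaller (here refl))))
                                   (smaller-neighbour-is-parent (Adj-sym tree {y} {top} y~top) (smaller (there y∈))))

  acyclic : ¬ HasCycle tree
  acyclic (x , ys , cycle) = rotated (∈-∃++ top∈)
    where
    top : Fin n
    top = argmax toℕ x ys
    top∈ : top ∈ₗ x ∷ ys
    top∈ = argmax-all toℕ (here refl) (All.tabulate there)
    below : All (λ y → toℕ y ≤ toℕ top) (x ∷ ys)
    below = f[⊥]≤f[argmax] {f = toℕ} x ys ∷ f[xs]≤f[argmax] {f = toℕ} x ys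
    rotated : (∃₂ λ pre post → x ∷ ys ≡ pre ++ top ∷ post) → ⊥
    rotated (pre , post , x∷ys≡) =
      no-cycle-through-max top (post ++ pre) (Cycle-rotate tree pre top post (subst (Cycle tree) x∷ys≡ cycle))
        (All.tabulate (λ y∈ → All.lookup below (subst (_ ∈ₗ_) (sym x∷ys≡) (reorder y∈))))
      where
      reorder : ∀ {y} → y ∈ₗ post ++ pre → y ∈ₗ pre ++ top ∷ post
      reorder y∈ with ∈-++⁻ post y∈
      ... | inj₁ y∈post = ∈-++⁺ʳ pre (there y∈post)
      ... | inj₂ y∈pre  = ∈-++⁺ˡ y∈pre

  isTree : IsTree tree
  isTree = connected , acyclic

  parentCount : ℕ → ℕ
  parentCount v = ∑< n (λ w → 𝟙 (child? v w))

  childCount : ℕ → ℕ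
  childCount v = ∑< n (λ w → 𝟙 (child? w v))

  degree≡parentCount+childCount : ∀ v → degree tree v ≡ parentCount (toℕ v) + childCount (toℕ v)
  degree≡parentCount+childCount v =
    trans (sum-allFin n (λ w → 𝟙 (edge? (toℕ v) w)))
      (trans (∑<-cong n (λ w _ → split (toℕ v) w)) (∑<-+ n (λ w → 𝟙 (child? (toℕ v) w)) (λ w → 𝟙 (child? w (toℕ v)))))
    where
    split : ∀ a b → 𝟙 (child? a b ⊎-dec child? b a) ≡ 𝟙 (child? a b) + 𝟙 (child? b a)
    split a b = exclusive (does (child? a b)) (does (child? b a))
      (λ ab ba → Child-asym (does⇒witness (child? a b) ab) (does⇒witness (child? b a) ba))
      where
      exclusive : ∀ x y → (x ≡ true → y ≡ true → ⊥) →
        (if x ∨ y then 1 else 0) ≡ (if x then 1 else 0) + (if y then 1 else 0)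
      exclusive true  true  x∧y = contradiction refl (x∧y refl)
      exclusive true  false _   = refl
      exclusive false _     _   = refl

  parentCount-root : parentCount 0 ≡ 0
  parentCount-root = ∑<-vanishing n (λ w _ → 𝟙-no (child? 0 w) λ ())

  parentCount-nonroot : ∀ {a} → 0 < a → a < n → parentCount a ≡ 1
  parentCount-nonroot {a} a>0 a<n =
    ∑<-indicator-single n (par a) (<-trans (par< a a>0) a<n) (𝟙-yes (child? a (par a)) (a>0 , refl))
      (λ w _ w≢pa → 𝟙-no (child? a w) (λ (_ , pa≡w) → w≢pa (sym pa≡w)))

  BlueAt : Subset n → ℕ → Set
  BlueAt S i = ∀ v → toℕ v ≡ i → Blue tree S v

  initialAt : ∀ s i → s i ≡ true → BlueAt (tab s) i
  initialAt s i si v refl = initial (∈-tab⁺ s v si)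

  forceAt : ∀ {S i c} → i < n → BlueAt S i → Edge i c →
    (∀ w → w < n → Edge i w → w ≢ c → BlueAt S w) → BlueAt S c
  forceAt {i = i} i<n blue-i i~c others v refl =
    force (blue-i u toℕ-u) (Edge⇒Adj {u} (subst (λ a → Edge a (toℕ v)) (sym toℕ-u) i~c))
      (λ w u~w w≢v → others (toℕ w) (Fin.toℕ<n w) (subst (λ a → Edge a (toℕ w)) toℕ-u (Adj⇒Edge {u} {w} u~w))
                              (w≢v ∘ Fin.toℕ-injective) w refl)
    where
    u : Fin n
    u = fromℕ< i<n
    toℕ-u : toℕ u ≡ i
    toℕ-u = Fin.toℕ-fromℕ< i<n

  IsIndexFort : (ℕ → Set) → Set
  IsIndexFort F = ∀ u c → u < n → c < n → Edge u c → F c → F u ⊎ ∃ λ w → w < n × Edge u w × w ≢ c × F w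

  fort⇒¬zeroForcing : ∀ {S F} → IsIndexFort F → (∀ v → F (toℕ v) → v ∉ S) →
    ∀ i → i < n → F i → ¬ IsZeroForcingSet tree S
  fort⇒¬zeroForcing {S} {F} fort F∩S=∅ i i<n Fi zfs =
    fort-stays-white tree isFort F∩S=∅ (zfs (fromℕ< i<n)) (subst F (sym (Fin.toℕ-fromℕ< i<n)) Fi)
    where
    isFort : IsFort tree (F ∘ toℕ)
    isFort u v u~v Fv with fort (toℕ u) (toℕ v) (Fin.toℕ<n u) (Fin.toℕ<n v) (Adj⇒Edge {u} {v} u~v) Fv
    ... | inj₁ Fu                       = inj₁ Fu
    ... | inj₂ (w , w<n , u~w , w≢v , Fw) =
      inj₂ (fromℕ< w<n , Edge⇒Adj {u} (subst (Edge (toℕ u)) (sym toℕ-w) u~w) ,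
            (λ eq → w≢v (trans (sym toℕ-w) (cong toℕ eq))) , subst F (sym toℕ-w) Fw)
      where
      toℕ-w : toℕ (fromℕ< w<n) ≡ w
      toℕ-w = Fin.toℕ-fromℕ< w<n

module _ (m : ℕ) {par₁ par₂ : ℕ → ℕ} (par₁< : ∀ w → 0 < w → par₁ w < w) (par₂< : ∀ w → 0 < w → par₂ w < w) where

  private
    module T₁ = ParentTree m par₁ par₁<
    module T₂ = ParentTree m par₂ par₂<

  childCount-≗⇒degree-≗ : (∀ v → v < suc m → T₁.childCount v ≡ T₂.childCount v) →
    ∀ v → degree T₁.tree v ≡ degree T₂.tree v
  childCount-≗⇒degree-≗ children≗ v = begin
    degree T₁.tree v                                  ≡⟨ T₁.degree≡parentCount+childCount v ⟩
    T₁.parentCount (toℕ v) + T₁.childCount (toℕ v)    ≡⟨ cong₂ _+_ (parents≗ (toℕ v) (Fin.toℕ<n v)) (children≗ (toℕ v) (Fin.toℕ<n v)) ⟩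
    T₂.parentCount (toℕ v) + T₂.childCount (toℕ v)    ≡⟨ T₂.degree≡parentCount+childCount v ⟨
    degree T₂.tree v                                  ∎
    where
    open ≡-Reasoning
    parents≗ : ∀ a → a < suc m → T₁.parentCount a ≡ T₂.parentCount a
    parents≗ zero    _   = trans T₁.parentCount-root (sym T₂.parentCount-root)
    parents≗ (suc a) a<n = trans (T₁.parentCount-nonroot z<s a<n) (sym (T₂.parentCount-nonroot z<s a<n))

Unique-⊆⇒length≤ : ∀ {A : Set} (xs ys : List A) → Unique xs → (∀ {x} → x ∈ₗ xs → x ∈ₗ ys) → length xs ≤ length ys
Unique-⊆⇒length≤ []       ys _               _    = z≤n
Unique-⊆⇒length≤ (x ∷ xs) ys (x∉xs ∷ unique) xs⊆ys with ∈-∃++ (xs⊆ys (here refl))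
... | ys₁ , ys₂ , refl = begin
  suc (length xs)                ≤⟨ s≤s (Unique-⊆⇒length≤ xs (ys₁ ++ ys₂) unique xs⊆ys₁ys₂) ⟩
  suc (length (ys₁ ++ ys₂))      ≡⟨ cong suc (length-++ ys₁) ⟩
  suc (length ys₁ + length ys₂)  ≡⟨ +-suc (length ys₁) (length ys₂) ⟨
  length ys₁ + length (x ∷ ys₂)  ≡⟨ length-++ ys₁ ⟨
  length (ys₁ ++ x ∷ ys₂)        ∎
  where
  open ≤-Reasoning
  xs⊆ys₁ys₂ : ∀ {y} → y ∈ₗ xs → y ∈ₗ ys₁ ++ ys₂
  xs⊆ys₁ys₂ y∈xs with ∈-++⁻ ys₁ (xs⊆ys (there y∈xs))
  ... | inj₁ y∈ys₁          = ∈-++⁺ˡ y∈ys₁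
  ... | inj₂ (here refl)    = contradiction refl (All.lookup x∉xs y∈xs)
  ... | inj₂ (there y∈ys₂)  = ∈-++⁺ʳ ys₁ y∈ys₂

length-cartesianProductWith : ∀ {A B C : Set} (f : A → B → C) xs ys →
  length (cartesianProductWith f xs ys) ≡ length xs * length ys
length-cartesianProductWith f []       ys = refl
length-cartesianProductWith f (x ∷ xs) ys =
  trans (length-++ (map (f x) ys)) (cong₂ _+_ (length-map (f x) ys) (length-cartesianProductWith f xs ys))

allBoolVecs : ∀ l → List (Vec Bool l)
allBoolVecs zero    = [ [] ]
allBoolVecs (suc l) = map (true ∷_) (allBoolVecs l) ++ map (false ∷_) (allBoolVecs l)

length-allBoolVecs : ∀ l → length (allBoolVecs l) ≡ 2 ^ l
length-allBoolVecs zero    = refl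
length-allBoolVecs (suc l) = begin
  length (map (true ∷_) vs ++ map (false ∷_) vs)         ≡⟨ length-++ (map (true ∷_) vs) ⟩
  length (map (true ∷_) vs) + length (map (false ∷_) vs) ≡⟨ cong₂ _+_ (length-map _ vs) (length-map _ vs) ⟩
  length vs + length vs                                   ≡⟨ cong (λ x → x + x) (length-allBoolVecs l) ⟩
  2 ^ l + 2 ^ l                                           ≡⟨ cong (2 ^ l +_) (+-identityʳ (2 ^ l)) ⟨
  2 ^ suc l                                               ∎
  where
  open ≡-Reasoning
  vs = allBoolVecs l

allBoolVecs-unique : ∀ l → Unique (allBoolVecs l)
allBoolVecs-unique zero    = [] ∷ []
allBoolVecs-unique (suc l) =
  Unique.++⁺ (Unique.map⁺ ∷-injectiveʳ (allBoolVecs-unique l)) (Unique.map⁺ ∷-injectiveʳ (allBoolVecs-unique l)) disjoint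
  where
  ∷-injectiveʳ : ∀ {b} {xs ys : Vec Bool l} → b Vec.∷ xs ≡ b ∷ ys → xs ≡ ys
  ∷-injectiveʳ refl = refl
  disjoint : ∀ {v} → v ∈ₗ map (true ∷_) (allBoolVecs l) × v ∈ₗ map (false ∷_) (allBoolVecs l) → ⊥
  disjoint (v∈ , v∈′) with ∈-map⁻ (true ∷_) v∈ | ∈-map⁻ (false ∷_) v∈′
  ... | _ , _ , refl | _ , _ , ()

-- 9ⁿ ≤ 2ᵏ⁻² 8ⁿ for n = 2k + 1 and k = 4 + i
nine-eighths-bound : ∀ i → 9 ^ suc ((4 + i) + (4 + i)) ≤ 2 ^ (2 + i) * 8 ^ suc ((4 + i) + (4 + i))
nine-eighths-bound zero    = ≤ᵇ⇒≤ (9 ^ 9) (4 * 8 ^ 9) _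
nine-eighths-bound (suc i) =
  subst (λ x → 9 ^ x ≤ 2 ^ (3 + i) * 8 ^ x) (sym exponent≡) (begin
  9 * (9 * 9 ^ e)              ≡⟨ *-assoc 9 9 (9 ^ e) ⟨
  81 * 9 ^ e                   ≤⟨ *-mono-≤ (≤ᵇ⇒≤ 81 128 _) (nine-eighths-bound i) ⟩
  128 * (2 ^ (2 + i) * 8 ^ e)  ≡⟨ rearrange (2 ^ (2 + i)) (8 ^ e) ⟩
  2 ^ (3 + i) * 8 ^ (2 + e)    ∎)
  where
  open ≤-Reasoning
  e = suc ((4 + i) + (4 + i))
  exponent≡ : suc ((4 + suc i) + (4 + suc i)) ≡ 2 + e
  exponent≡ = cong (6 +_) (+-suc i (4 + i))
  rearrange : ∀ a b → 128 * (a * b) ≡ (2 * a) * (8 * (8 * b))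
  rearrange = solve-∀

-- The spider with k = 2 + c legs of length two: leg i (1 ≤ i ≤ k) is the path 0 — i — k + i.
module Spider (c : ℕ) where

  k : ℕ
  k = 2 + c

  parent : ℕ → ℕ
  parent w with w ≤? k
  ... | yes _ = 0
  ... | no  _ = w ∸ k

  k+i≰k : ∀ {i} → 0 < i → k + i ≰ k
  k+i≰k {suc i} _ = m+1+n≰m k

  parent-mid : ∀ {i} → i ≤ k → parent i ≡ 0
  parent-mid {i} i≤k with i ≤? k
  ... | yes _   = refl
  ... | no  i≰k = contradiction i≤k i≰k

  parent-tip : ∀ {i} → 0 < i → parent (k + i) ≡ i
  parent-tip {i} i>0 with k + i ≤? k
  ... | yes k+i≤k = contradiction k+i≤k (k+i≰k i>0)
  ... | no  _     = m+n∸m≡n k i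

  parent< : ∀ w → 0 < w → parent w < w
  parent< w w>0 with w ≤? k
  ... | yes _   = w>0
  ... | no  w≰k = ∸-monoʳ-< {o = 0} z<s (<⇒≤ (≰⇒> w≰k))

  open ParentTree (k + k) parent parent< public

  data Vertex : ℕ → Set where
    centre : Vertex 0
    mid    : ∀ {i} → 0 < i → i ≤ k → Vertex i
    tip    : ∀ {i} → 0 < i → i ≤ k → Vertex (k + i)

  vertex : ∀ {w} → w < n → Vertex w
  vertex {zero}  _   = centre
  vertex {suc w} w<n with suc w ≤? k
  ... | yes w≤k = mid z<s w≤k
  ... | no  w≰k = subst Vertex (m+[n∸m]≡n (<⇒≤ k<w)) (tip (m<n⇒0<n∸m k<w) w∸k≤k)
    where
    k<w : k < suc w
    k<w = ≰⇒> w≰k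
    w∸k≤k : suc w ∸ k ≤ k
    w∸k≤k = ≤-trans (∸-monoˡ-≤ k (s≤s⁻¹ w<n)) (≤-reflexive (m+n∸m≡n k k))

  mid<n : ∀ {i} → i ≤ k → i < n
  mid<n i≤k = s≤s (≤-trans i≤k (m≤m+n k k))

  tip<n : ∀ {i} → i ≤ k → k + i < n
  tip<n i≤k = s≤s (+-monoʳ-≤ k i≤k)

  mid↑centre : ∀ {i} → 0 < i → i ≤ k → Child i 0
  mid↑centre i>0 i≤k = i>0 , parent-mid i≤k

  tip↑mid : ∀ {i} → 0 < i → Child (k + i) i
  tip↑mid {i} i>0 = <-≤-trans i>0 (m≤n+m i k) , parent-tip i>0

  centre-neighbour : ∀ {w} → w < n → Edge 0 w → 0 < w × w ≤ k
  centre-neighbour w<n (inj₁ (() , _))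
  centre-neighbour w<n (inj₂ (w>0 , pw≡0)) with vertex w<n
  ... | centre      = contradiction w>0 (<-irrefl refl)
  ... | mid i>0 i≤k = i>0 , i≤k
  ... | tip i>0 _   = contradiction (trans (sym (parent-tip i>0)) pw≡0) (≢-sym (<⇒≢ i>0))

  mid-neighbour : ∀ {i w} → 0 < i → i ≤ k → w < n → Edge i w → w ≡ 0 ⊎ w ≡ k + i
  mid-neighbour i>0 i≤k w<n (inj₁ (_ , pi≡w))  = inj₁ (trans (sym pi≡w) (parent-mid i≤k))
  mid-neighbour i>0 i≤k w<n (inj₂ (w>0 , pw≡i)) with vertex w<n
  ... | centre    = contradiction w>0 (<-irrefl refl)
  ... | mid _ w≤k = contradiction (trans (sym (parent-mid w≤k)) pw≡i) (<⇒≢ i>0)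
  ... | tip a>0 _ = inj₂ (cong (k +_) (trans (sym (parent-tip a>0)) pw≡i))

  tip-neighbour : ∀ {i w} → 0 < i → w < n → Edge (k + i) w → w ≡ i
  tip-neighbour i>0 w<n (inj₁ (_ , p≡w))     = trans (sym p≡w) (parent-tip i>0)
  tip-neighbour i>0 w<n (inj₂ (w>0 , pw≡ki)) with vertex w<n
  ... | centre    = contradiction w>0 (<-irrefl refl)
  ... | mid _ w≤k = contradiction (trans (sym (parent-mid w≤k)) pw≡ki) (<⇒≢ (<-≤-trans i>0 (m≤n+m _ k)))
  ... | tip a>0 a≤k = contradiction (subst (_≤ k) (trans (sym (parent-tip a>0)) pw≡ki) a≤k) (k+i≰k i>0)

  childCount-centre : childCount 0 ≡ k
  childCount-centre = ∑<-indicator-interval n 1 (suc k) (s≤s z≤n) (s≤s (m≤m+n k k))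
    (λ w w>0 w<1+k → 𝟙-yes (child? w 0) (mid↑centre w>0 (s≤s⁻¹ w<1+k)))
    (λ w w<n outside → 𝟙-no (child? w 0) λ w↑0 →
      [ <⇒≱ (proj₁ w↑0) ∘ s≤s⁻¹ , <⇒≱ (s≤s (proj₂ (centre-neighbour w<n (inj₂ w↑0)))) ]′ outside)

  childCount-mid : ∀ {i} → 0 < i → i ≤ k → childCount i ≡ 1
  childCount-mid {i} i>0 i≤k = ∑<-indicator-single n (k + i) (tip<n i≤k)
    (𝟙-yes (child? (k + i) i) (tip↑mid i>0))
    (λ w w<n w≢k+i → 𝟙-no (child? w i) λ w↑i →
      [ (λ w≡0 → <⇒≢ (proj₁ w↑i) (sym w≡0)) , w≢k+i ]′ (mid-neighbour i>0 i≤k w<n (inj₂ w↑i)))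

  childCount-tip : ∀ {i} → 0 < i → i ≤ k → childCount (k + i) ≡ 0
  childCount-tip {i} i>0 i≤k = ∑<-vanishing n (λ w w<n → 𝟙-no (child? w (k + i)) λ w↑tip →
    let w≡i = tip-neighbour i>0 w<n (inj₂ w↑tip) in
    <⇒≢ (<-≤-trans i>0 (m≤n+m i k)) (trans (sym (parent-mid i≤k)) (subst (λ x → parent x ≡ k + i) w≡i (proj₂ w↑tip))))

  OnLeg : ℕ → ℕ → Set
  OnLeg i w = w ≡ i ⊎ w ≡ k + i

  two-empty-legs⇒¬zeroForcing : ∀ {S p q} → 0 < p → p ≤ k → 0 < q → q ≤ k → p ≢ q →
    (∀ v → OnLeg p (toℕ v) ⊎ OnLeg q (toℕ v) → v ∉ S) → ¬ IsZeroForcingSet tree S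
  two-empty-legs⇒¬zeroForcing {p = p} {q} p>0 p≤k q>0 q≤k p≢q empty =
    fort⇒¬zeroForcing fort empty p (mid<n p≤k) (inj₁ (inj₁ refl))
    where
    F : ℕ → Set
    F w = OnLeg p w ⊎ OnLeg q w
    leg-closed : ∀ {i r} → 0 < i → i ≤ k → 0 < r → r ≤ k → r ≢ i → (∀ {w} → OnLeg i w → F w) → F r →
      ∀ u c → u < n → Edge u c → OnLeg i c → F u ⊎ ∃ λ w → w < n × Edge u w × w ≢ c × F w
    leg-closed {r = r} i>0 i≤k r>0 r≤k r≢i legᵢ Fr u c u<n u~c (inj₁ refl)
      with mid-neighbour i>0 i≤k u<n (Edge-sym u~c)
    ... | inj₁ refl = inj₂ (r , mid<n r≤k , inj₂ (mid↑centre r>0 r≤k) , r≢i , Fr)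
    ... | inj₂ refl = inj₁ (legᵢ (inj₂ refl))
    leg-closed i>0 _ _ _ _ legᵢ _ u c u<n u~c (inj₂ refl) with tip-neighbour i>0 u<n (Edge-sym u~c)
    ... | refl = inj₁ (legᵢ (inj₁ refl))
    fort : IsIndexFort F
    fort u c u<n _ u~c (inj₁ onP) = leg-closed p>0 p≤k q>0 q≤k (≢-sym p≢q) inj₁ (inj₂ (inj₁ refl)) u c u<n u~c onP
    fort u c u<n _ u~c (inj₂ onQ) = leg-closed q>0 q≤k p>0 p≤k p≢q inj₂ (inj₁ (inj₁ refl)) u c u<n u~c onQ

  data Pick : Set where
    none takeMid takeTip : Pick

  isMid : Pick → Bool
  isMid takeMid = true
  isMid _       = false

  isTip : Pick → Bool
  isTip takeTip = true
  isTip _       = false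

  isMid-true : ∀ {p} → isMid p ≡ true → p ≡ takeMid
  isMid-true {takeMid} _ = refl

  isTip-true : ∀ {p} → isTip p ≡ true → p ≡ takeTip
  isTip-true {takeTip} _ = refl

  picked : (ℕ → Pick) → ℕ → Bool
  picked pick zero    = false
  picked pick (suc w) with suc w ≤? k
  ... | yes _ = isMid (pick (suc w))
  ... | no  _ = isTip (pick (suc w ∸ k))

  picked-mid : ∀ pick {i} → 0 < i → i ≤ k → picked pick i ≡ isMid (pick i)
  picked-mid pick {suc i} _ i≤k with suc i ≤? k
  ... | yes _   = refl
  ... | no  i≰k = contradiction i≤k i≰k

  picked-tip : ∀ pick {i} → 0 < i → picked pick (k + i) ≡ isTip (pick i)
  picked-tip pick {i} i>0 with k + i ≤? k
  ... | yes k+i≤k = contradiction k+i≤k (k+i≰k i>0)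
  ... | no  _     = cong (isTip ∘ pick) (m+n∸m≡n k i)

  1≤k : 1 ≤ k
  1≤k = s≤s z≤n

  2≤k : 2 ≤ k
  2≤k = s≤s (s≤s z≤n)

  module PickedSet (pick : ℕ → Pick) (pick-1 : pick 1 ≡ takeTip) (pick-2 : pick 2 ≡ none)
                   (picks : ∀ {i} → 0 < i → i ≤ k → i ≢ 2 → pick i ≢ none) where

    S : Subset n
    S = tab (picked pick)

    mid-initial : ∀ {i} → 0 < i → i ≤ k → pick i ≡ takeMid → BlueAt S i
    mid-initial {i} i>0 i≤k pick-i = initialAt (picked pick) i (trans (picked-mid pick i>0 i≤k) (cong isMid pick-i))

    tip-initial : ∀ {i} → 0 < i → pick i ≡ takeTip → BlueAt S (k + i)
    tip-initial {i} i>0 pick-i = initialAt (picked pick) (k + i) (trans (picked-tip pick i>0) (cong isTip pick-i))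

    tip⇒mid : ∀ {i} → 0 < i → i ≤ k → BlueAt S (k + i) → BlueAt S i
    tip⇒mid i>0 i≤k blue = forceAt (tip<n i≤k) blue (inj₁ (tip↑mid i>0))
      (λ w w<n tip~w w≢i → contradiction (tip-neighbour i>0 w<n tip~w) w≢i)

    mid⇒tip : ∀ {i} → 0 < i → i ≤ k → BlueAt S 0 → BlueAt S i → BlueAt S (k + i)
    mid⇒tip {i} i>0 i≤k blue-centre blue-mid = forceAt (mid<n i≤k) blue-mid (inj₂ (tip↑mid i>0)) others
      where
      others : ∀ w → w < n → Edge i w → w ≢ k + i → BlueAt S w
      others w w<n mid~w w≢tip with mid-neighbour i>0 i≤k w<n mid~w
      ... | inj₁ refl  = blue-centre
      ... | inj₂ w≡tip = contradiction w≡tip w≢tip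

    picked-leg-blue : ∀ {i} → 0 < i → i ≤ k → i ≢ 2 → BlueAt S i
    picked-leg-blue {i} i>0 i≤k i≢2 with pick i in pick-i
    ... | none    = contradiction pick-i (picks i>0 i≤k i≢2)
    ... | takeMid = mid-initial i>0 i≤k pick-i
    ... | takeTip = tip⇒mid i>0 i≤k (tip-initial i>0 pick-i)

    centre-blue : BlueAt S 0
    centre-blue = forceAt (mid<n 1≤k) (picked-leg-blue z<s 1≤k λ ()) (inj₁ (mid↑centre z<s 1≤k)) others
      where
      others : ∀ w → w < n → Edge 1 w → w ≢ 0 → BlueAt S w
      others w w<n 1~w w≢0 with mid-neighbour z<s 1≤k w<n 1~w
      ... | inj₁ w≡0 = contradiction w≡0 w≢0
      ... | inj₂ refl = tip-initial z<s pick-1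

    mid-blue : ∀ {i} → 0 < i → i ≤ k → BlueAt S i
    mid-blue {i} i>0 i≤k with i ≟ 2
    ... | no  i≢2 = picked-leg-blue i>0 i≤k i≢2
    ... | yes refl = forceAt z<s centre-blue (inj₂ (mid↑centre z<s 2≤k)) others
      where
      others : ∀ w → w < n → Edge 0 w → w ≢ 2 → BlueAt S w
      others w w<n 0~w w≢2 = let w>0 , w≤k = centre-neighbour w<n 0~w in picked-leg-blue w>0 w≤k w≢2

    zeroForcing : IsZeroForcingSet tree S
    zeroForcing v = blue (vertex (Fin.toℕ<n v)) v refl
      where
      blue : ∀ {w} → Vertex w → BlueAt S w
      blue centre        = centre-blue
      blue (mid i>0 i≤k) = mid-blue i>0 i≤k
      blue (tip i>0 i≤k) = mid⇒tip i>0 i≤k centre-blue (mid-blue i>0 i≤k)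

    leg-2-empty : ∀ v → OnLeg 2 (toℕ v) → v ∉ S
    leg-2-empty v (inj₁ v≡2)   = ∉-tab (picked pick) v (trans (cong (picked pick) v≡2) (trans (picked-mid pick z<s 2≤k) (cong isMid pick-2)))
    leg-2-empty v (inj₂ v≡k+2) = ∉-tab (picked pick) v (trans (cong (picked pick) v≡k+2) (trans (picked-tip pick z<s) (cong isTip pick-2)))

    SoleOnItsLeg : Fin n → Set
    SoleOnItsLeg v = ∃ λ i → 0 < i × i ≤ k × i ≢ 2 × OnLeg i (toℕ v) × (∀ u → OnLeg i (toℕ u) → u ∈ S → u ≡ v)

    alone-on-its-leg : ∀ v → v ∈ S → SoleOnItsLeg v
    alone-on-its-leg v v∈S = on (vertex (Fin.toℕ<n v)) refl (∈-tab⁻ (picked pick) v v∈S)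
      where
      same : ∀ {u w} → toℕ u ≡ w → toℕ v ≡ w → u ≡ v
      same u≡w v≡w = Fin.toℕ-injective (trans u≡w (sym v≡w))
      not-2 : ∀ {i p} → pick i ≡ p → p ≢ none → i ≢ 2
      not-2 pick-i p≢none refl = p≢none (trans (sym pick-i) pick-2)
      on : ∀ {w} → Vertex w → toℕ v ≡ w → picked pick w ≡ true → SoleOnItsLeg v
      on centre _ ()
      on (mid {i} i>0 i≤k) v≡i v-picked = i , i>0 , i≤k , not-2 pick-i (λ ()) , inj₁ v≡i , alone
        where
        pick-i : pick i ≡ takeMid
        pick-i = isMid-true (trans (sym (picked-mid pick i>0 i≤k)) v-picked)
        alone : ∀ u → OnLeg i (toℕ u) → u ∈ S → u ≡ v
        alone u (inj₁ u≡i) _   = same u≡i v≡i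
        alone u (inj₂ u≡k+i) u∈S = contradiction u∈S (∉-tab (picked pick) u
          (trans (cong (picked pick) u≡k+i) (trans (picked-tip pick i>0) (cong isTip pick-i))))
      on (tip {i} i>0 i≤k) v≡k+i v-picked = i , i>0 , i≤k , not-2 pick-i (λ ()) , inj₂ v≡k+i , alone
        where
        pick-i : pick i ≡ takeTip
        pick-i = isTip-true (trans (sym (picked-tip pick i>0)) v-picked)
        alone : ∀ u → OnLeg i (toℕ u) → u ∈ S → u ≡ v
        alone u (inj₁ u≡i) u∈S = contradiction u∈S (∉-tab (picked pick) u
          (trans (cong (picked pick) u≡i) (trans (picked-mid pick i>0 i≤k) (cong isMid pick-i))))
        alone u (inj₂ u≡k+i) _ = same u≡k+i v≡k+i

    minimal : ∀ S′ → S′ ⊂ S → ¬ IsZeroForcingSet tree S′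
    minimal S′ (S′⊆S , x , x∈S , x∉S′) with alone-on-its-leg x x∈S
    ... | i , i>0 , i≤k , i≢2 , _ , alone =
      two-empty-legs⇒¬zeroForcing i>0 i≤k z<s 2≤k i≢2 empty
      where
      empty : ∀ v → OnLeg i (toℕ v) ⊎ OnLeg 2 (toℕ v) → v ∉ S′
      empty v (inj₁ v-on-i) v∈S′ = x∉S′ (subst (_∈ S′) (alone v v-on-i (S′⊆S v∈S′)) v∈S′)
      empty v (inj₂ v-on-2)      = leg-2-empty v v-on-2 ∘ S′⊆S

    isMinimal : IsMinimalZFS tree S
    isMinimal = zeroForcing , minimal

  choice : ∀ {l} → Vec Bool l → ℕ → Pick
  choice []       _       = none
  choice (b ∷ bs) zero    = if b then takeTip else takeMid
  choice (b ∷ bs) (suc t) = choice bs t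

  choice-≢none : ∀ {l} (bs : Vec Bool l) {t} → t < l → choice bs t ≢ none
  choice-≢none (true  ∷ bs) {zero}  _   ()
  choice-≢none (false ∷ bs) {zero}  _   ()
  choice-≢none (b     ∷ bs) {suc t} t<l = choice-≢none bs (s<s⁻¹ t<l)

  choice-injective : ∀ {l} (bs bs′ : Vec Bool l) →
    (∀ t → t < l → isMid (choice bs t) ≡ isMid (choice bs′ t)) → bs ≡ bs′
  choice-injective []       []         _    = refl
  choice-injective (b ∷ bs) (b′ ∷ bs′) same =
    cong₂ _∷_ (head b b′ (same 0 z<s)) (choice-injective bs bs′ (λ t t<l → same (suc t) (s<s t<l)))
    where
    head : ∀ b b′ → isMid (if b then takeTip else takeMid) ≡ isMid (if b′ then takeTip else takeMid) → b ≡ b′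
    head true  true  _ = refl
    head false false _ = refl

  pickOf : Vec Bool c → ℕ → Pick
  pickOf bs (suc zero)          = takeTip
  pickOf bs (suc (suc (suc t))) = choice bs t
  pickOf bs _                   = none

  pickOf-picks : ∀ bs {i} → 0 < i → i ≤ k → i ≢ 2 → pickOf bs i ≢ none
  pickOf-picks bs {1}                 _ _   _   ()
  pickOf-picks bs {2}                 _ _   i≢2 = contradiction refl i≢2
  pickOf-picks bs {suc (suc (suc t))} _ i≤k _   = choice-≢none bs (s≤s⁻¹ (s≤s⁻¹ i≤k))

  legSet : Vec Bool c → Subset n
  legSet bs = PickedSet.S (pickOf bs) refl refl (pickOf-picks bs)

  legSet-minimal : ∀ bs → IsMinimalZFS tree (legSet bs)
  legSet-minimal bs = PickedSet.isMinimal (pickOf bs) refl refl (pickOf-picks bs)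

  legSet-injective : ∀ {bs bs′} → legSet bs ≡ legSet bs′ → bs ≡ bs′
  legSet-injective {bs} {bs′} eq = choice-injective bs bs′ λ t t<c →
    let 3+t≤k = s≤s (s≤s t<c)
        v     = fromℕ< (mid<n 3+t≤k)
        at : ∀ bs → Vec.lookup (legSet bs) v ≡ isMid (choice bs t)
        at bs = trans (Vec.lookup∘tabulate (picked (pickOf bs) ∘ toℕ) v)
                  (trans (cong (picked (pickOf bs)) (Fin.toℕ-fromℕ< (mid<n 3+t≤k))) (picked-mid (pickOf bs) z<s 3+t≤k))
    in trans (sym (at bs)) (trans (cong (λ S → Vec.lookup S v) eq) (at bs′))

  legSets : List (Subset n)
  legSets = map legSet (allBoolVecs c)

  length-legSets : length legSets ≡ 2 ^ c
  length-legSets = trans (length-map legSet (allBoolVecs c)) (length-allBoolVecs c)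

  legSets-unique : Unique legSets
  legSets-unique = Unique.map⁺ legSet-injective (allBoolVecs-unique c)

  legSets-minimal : All (IsMinimalZFS tree) legSets
  legSets-minimal = All.map⁺ (All.tabulate (λ {bs} _ → legSet-minimal bs))

-- The broom: the path 0 — 1 — ⋯ — k + 1 with the k − 1 leaves k + 2, …, 2k attached to 0.
module Broom (j : ℕ) where

  k : ℕ
  k = 3 + j

  parent : ℕ → ℕ
  parent w with w ≤? suc k
  ... | yes _ = pred w
  ... | no  _ = 0

  Leaf : ℕ → Set
  Leaf w = 2 + k ≤ w

  path-or-leaf : ∀ w → w ≤ suc k ⊎ Leaf w
  path-or-leaf w with w ≤? suc k
  ... | yes w≤1+k = inj₁ w≤1+k
  ... | no  w≰1+k = inj₂ (≰⇒> w≰1+k)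

  parent-path : ∀ {w} → w ≤ suc k → parent w ≡ pred w
  parent-path {w} w≤1+k with w ≤? suc k
  ... | yes _     = refl
  ... | no  w≰1+k = contradiction w≤1+k w≰1+k

  parent-leaf : ∀ {w} → Leaf w → parent w ≡ 0
  parent-leaf {w} leaf with w ≤? suc k
  ... | yes w≤1+k = contradiction w≤1+k (<⇒≱ leaf)
  ... | no  _     = refl

  parent< : ∀ w → 0 < w → parent w < w
  parent< (suc w) w>0 with suc w ≤? suc k
  ... | yes _ = ≤-refl
  ... | no  _ = w>0

  parent≤k : ∀ w → parent w ≤ k
  parent≤k w with w ≤? suc k
  ... | yes w≤1+k = pred-mono-≤ w≤1+k
  ... | no  _     = z≤n

  open ParentTree (k + k) parent parent< public

  leaf<n : ∀ {l} → l ≤ k + k → l < n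
  leaf<n = s≤s

  path<n : ∀ {i} → i ≤ suc k → i < n
  path<n i≤1+k = s≤s (≤-trans i≤1+k (m<m+n k z<s))

  leaf↑centre : ∀ {l} → Leaf l → Child l 0
  leaf↑centre leaf = <-≤-trans z<s leaf , parent-leaf leaf

  path↑ : ∀ {i} → i ≤ k → Child (suc i) i
  path↑ i≤k = z<s , parent-path (s≤s i≤k)

  child-on-path : ∀ {w i} → w ≤ suc k → Child w i → w ≡ suc i
  child-on-path {w} w≤1+k (w>0 , pw≡i) =
    trans (sym (suc-pred w {{>-nonZero w>0}})) (cong suc (trans (sym (parent-path w≤1+k)) pw≡i))

  child-of-centre : ∀ {w} → Child w 0 → w ≡ 1 ⊎ Leaf w
  child-of-centre {w} child with path-or-leaf w
  ... | inj₁ w≤1+k = inj₁ (child-on-path w≤1+k child)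
  ... | inj₂ leaf  = inj₂ leaf

  child-of-path : ∀ {i w} → 0 < i → Child w i → w ≡ suc i × i ≤ k
  child-of-path {i} {w} i>0 child@(_ , pw≡i) with path-or-leaf w
  ... | inj₁ w≤1+k = w≡1+i , s≤s⁻¹ (subst (_≤ suc k) w≡1+i w≤1+k)
    where
    w≡1+i : w ≡ suc i
    w≡1+i = child-on-path w≤1+k child
  ... | inj₂ leaf  = contradiction (trans (sym (parent-leaf leaf)) pw≡i) (<⇒≢ i>0)

  no-child-beyond-k : ∀ {w i} → 0 < i → ¬ Child w (k + i)
  no-child-beyond-k {w} {suc i} _ (_ , pw≡k+i) = m+1+n≰m k (subst (_≤ k) pw≡k+i (parent≤k w))

  centre-neighbour : ∀ {w} → Edge 0 w → w ≡ 1 ⊎ Leaf w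
  centre-neighbour (inj₁ (() , _))
  centre-neighbour (inj₂ child) = child-of-centre child

  path-neighbour : ∀ {i w} → 0 < i → i ≤ suc k → Edge i w → w ≡ pred i ⊎ w ≡ suc i × i ≤ k
  path-neighbour i>0 i≤1+k (inj₁ (_ , pi≡w)) = inj₁ (trans (sym pi≡w) (parent-path i≤1+k))
  path-neighbour i>0 i≤1+k (inj₂ child)      = inj₂ (child-of-path i>0 child)

  leaf-neighbour : ∀ {l w} → Leaf l → Edge l w → w ≡ 0
  leaf-neighbour leaf (inj₁ (_ , pl≡w))   = trans (sym pl≡w) (parent-leaf leaf)
  leaf-neighbour {w = w} leaf (inj₂ (_ , pw≡l)) = contradiction (subst (_≤ k) pw≡l (parent≤k w)) (<⇒≱ (<-trans (n<1+n k) leaf))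

  childCount-centre : childCount 0 ≡ k
  childCount-centre = cong (λ leaves → 0 + (1 + leaves)) (trans
    (∑<-indicator-interval (2 + j + k) k (2 + j + k) (m≤n+m k (2 + j)) ≤-refl
      (λ w k≤w _ → 𝟙-yes (child? (2 + w) 0) (leaf↑centre (s≤s (s≤s k≤w))))
      (λ { w _ (inj₁ w<k) → 𝟙-no (child? (2 + w) 0) λ child →
             [ (λ ()) , <⇒≱ (s≤s (s≤s w<k)) ]′ (child-of-centre child)
         ; w w<n (inj₂ n≤w) → contradiction n≤w (<⇒≱ w<n) }))
    (m+n∸n≡m (2 + j) k))

  childCount-path : ∀ {i} → 0 < i → i ≤ k → childCount i ≡ 1
  childCount-path {i} i>0 i≤k = ∑<-indicator-single n (suc i) (path<n (s≤s i≤k)) (𝟙-yes (child? (suc i) i) (path↑ i≤k))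
    (λ w _ w≢1+i → 𝟙-no (child? w i) (w≢1+i ∘ proj₁ ∘ child-of-path i>0))

  childCount-beyond : ∀ {i} → 0 < i → childCount (k + i) ≡ 0
  childCount-beyond {i} i>0 = ∑<-vanishing n (λ w _ → 𝟙-no (child? w (k + i)) (no-child-beyond-k i>0))

  two-missing-leaves⇒¬zeroForcing : ∀ {S l₁ l₂} → Leaf l₁ → Leaf l₂ → l₁ < n → l₂ < n → l₁ ≢ l₂ →
    (∀ v → toℕ v ≡ l₁ ⊎ toℕ v ≡ l₂ → v ∉ S) → ¬ IsZeroForcingSet tree S
  two-missing-leaves⇒¬zeroForcing {l₁ = l₁} {l₂} leaf₁ leaf₂ l₁<n l₂<n l₁≢l₂ missing =
    fort⇒¬zeroForcing fort missing l₁ l₁<n (inj₁ refl)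
    where
    fort : IsIndexFort (λ w → w ≡ l₁ ⊎ w ≡ l₂)
    fort u _ _ _ u~l₁ (inj₁ refl) with leaf-neighbour leaf₁ (Edge-sym u~l₁)
    ... | refl = inj₂ (l₂ , l₂<n , inj₂ (leaf↑centre leaf₂) , ≢-sym l₁≢l₂ , inj₂ refl)
    fort u _ _ _ u~l₂ (inj₂ refl) with leaf-neighbour leaf₂ (Edge-sym u~l₂)
    ... | refl = inj₂ (l₁ , l₁<n , inj₂ (leaf↑centre leaf₁) , l₁≢l₂ , inj₁ refl)

  -- the missing leaf J and the white path vertices form a fort
  no-seed⇒¬zeroForcing : ∀ s {J} → Leaf J → J < n → s J ≡ false → s 1 ≡ false → s (suc k) ≡ false →
    (∀ {i} → 0 < i → i ≤ k → s i ≡ true → s (suc i) ≡ false) → ¬ IsZeroForcingSet tree (tab s)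
  no-seed⇒¬zeroForcing s {J} leaf J<n sJ s1 s[1+k] isolated =
    fort⇒¬zeroForcing fort missing 1 (path<n (s≤s z≤n)) (white z<s (s≤s z≤n) s1)
    where
    F : ℕ → Set
    F w = w ≡ J ⊎ (0 < w × w ≤ suc k × s w ≡ false)
    white : ∀ {w} → 0 < w → w ≤ suc k → s w ≡ false → F w
    white w>0 w≤1+k sw = inj₂ (w>0 , w≤1+k , sw)
    missing : ∀ v → F (toℕ v) → v ∉ tab s
    missing v (inj₁ v≡J)           = ∉-tab s v (trans (cong s v≡J) sJ)
    missing v (inj₂ (_ , _ , sv))  = ∉-tab s v sv
    J≢1 : J ≢ 1
    J≢1 J≡1 = contradiction (subst Leaf J≡1 leaf) λ { (s≤s ()) }
    isolated⁻ : ∀ {i} → 0 < i → i ≤ k → s (suc i) ≡ true → s i ≡ false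
    isolated⁻ {i} i>0 i≤k s[1+i] with s i in si
    ... | false = refl
    ... | true  = contradiction (trans (sym s[1+i]) (isolated i>0 i≤k si)) λ ()
    lower-white : ∀ c → 2 + c ≤ suc k → s (suc c) ≡ true → F c
    lower-white zero    _   s1≡true = contradiction (trans (sym s1≡true) s1) λ ()
    lower-white (suc c) c≤k s[2+c]  = white z<s (≤-trans (n≤1+n _) (≤-trans (n≤1+n _) c≤k)) (isolated⁻ z<s (s≤s⁻¹ (≤-trans (n≤1+n _) c≤k)) s[2+c])
    below : ∀ {c} → 0 < c → c ≤ suc k → F (pred c) ⊎ ∃ λ w → w < n × Edge (pred c) w × w ≢ c × F w
    below {1} _ _ = inj₂ (J , J<n , inj₂ (leaf↑centre leaf) , J≢1 , inj₁ refl)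
    below {suc (suc c)} _ c+2≤1+k with s (suc c) in s[1+c]
    ... | false = inj₁ (inj₂ (z<s , ≤-trans (n≤1+n _) c+2≤1+k , refl))
    ... | true  = inj₂ (c , path<n (≤-trans (n≤1+n _) (≤-trans (n≤1+n _) c+2≤1+k)) ,
                        inj₁ (path↑ (s≤s⁻¹ (≤-trans (n≤1+n _) c+2≤1+k))) ,
                        <⇒≢ (<-trans (n<1+n c) (n<1+n (suc c))) , lower-white c c+2≤1+k s[1+c])
    above : ∀ {c} → c ≤ k → F (suc c) ⊎ ∃ λ w → w < n × Edge (suc c) w × w ≢ c × F w
    above {c} c≤k with s (suc c) in s[1+c]
    ... | false = inj₁ (inj₂ (z<s , s≤s c≤k , refl))
    ... | true with m≤n⇒m<n∨m≡n c≤k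
    ...   | inj₂ refl = contradiction (trans (sym s[1+c]) s[1+k]) λ ()
    ...   | inj₁ c<k  = inj₂ (2 + c , path<n (s≤s c<k) , inj₂ (path↑ c<k) ,
                              ≢-sym (<⇒≢ (<-trans (n<1+n c) (n<1+n (suc c)))) ,
                              white z<s (s≤s c<k) (isolated z<s c<k s[1+c]))
    fort : IsIndexFort F
    fort u _ _ _ u~J (inj₁ refl) with leaf-neighbour leaf (Edge-sym u~J)
    ... | refl = inj₂ (1 , path<n (s≤s z≤n) , inj₂ (path↑ z≤n) , ≢-sym J≢1 , white z<s (s≤s z≤n) s1)
    fort u c _ _ u~c (inj₂ (c>0 , c≤1+k , _)) with path-neighbour c>0 c≤1+k (Edge-sym u~c)
    ... | inj₁ refl         = below c>0 c≤1+k
    ... | inj₂ (refl , c≤k) = above c≤k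

  3+k≤k+k : 3 + k ≤ k + k
  3+k≤k+k = +-monoˡ-≤ k (s≤s (s≤s (s≤s z≤n)))

  module AllLeavesBut (s : ℕ → Bool) (J : ℕ) (leaves-in : ∀ {l} → Leaf l → l < n → l ≢ J → s l ≡ true) where

    S : Subset n
    S = tab s

    leaf-forces-centre : ∀ {l} → Leaf l → l < n → l ≢ J → BlueAt S 0
    leaf-forces-centre leaf l<n l≢J = forceAt l<n (initialAt s _ (leaves-in leaf l<n l≢J)) (inj₁ (leaf↑centre leaf))
      (λ w _ l~w w≢0 → contradiction (leaf-neighbour leaf l~w) w≢0)

    centre-blue : BlueAt S 0
    centre-blue with J ≟ 2 + k
    ... | no  J≢2+k = leaf-forces-centre ≤-refl (leaf<n (≤-trans (n≤1+n _) 3+k≤k+k)) (≢-sym J≢2+k)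
    ... | yes refl  = leaf-forces-centre (n≤1+n _) (leaf<n 3+k≤k+k) (≢-sym (<⇒≢ (n<1+n _)))

    forward : ∀ {p} → suc p ≤ k → BlueAt S p → BlueAt S (suc p) → BlueAt S (2 + p)
    forward {p} p<k blue-p blue-1+p = forceAt (path<n (s≤s (<⇒≤ p<k))) blue-1+p (inj₂ (path↑ p<k)) others
      where
      others : ∀ w → w < n → Edge (suc p) w → w ≢ 2 + p → BlueAt S w
      others w _ e w≢2+p with path-neighbour z<s (s≤s (<⇒≤ p<k)) e
      ... | inj₁ refl       = blue-p
      ... | inj₂ (w≡2+p , _) = contradiction w≡2+p w≢2+p

    backward : ∀ {p} → p ≤ k → BlueAt S (suc p) → BlueAt S (2 + p) → BlueAt S p
    backward {p} p≤k blue-1+p blue-2+p = forceAt (path<n (s≤s p≤k)) blue-1+p (inj₁ (path↑ p≤k)) others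
      where
      others : ∀ w → w < n → Edge (suc p) w → w ≢ p → BlueAt S w
      others w _ e w≢p with path-neighbour z<s (s≤s p≤k) e
      ... | inj₁ w≡p      = contradiction w≡p w≢p
      ... | inj₂ (refl , _) = blue-2+p

    sweep-up : ∀ {p} d → p + d ≤ k → BlueAt S p → BlueAt S (suc p) → BlueAt S (suc (p + d))
    sweep-up {p} zero    _       _       blue-1+p = subst (BlueAt S ∘ suc) (sym (+-identityʳ p)) blue-1+p
    sweep-up {p} (suc d) p+d<k blue-p blue-1+p =
      subst (BlueAt S ∘ suc) (sym (+-suc p d))
        (sweep-up d (subst (_≤ k) (+-suc p d) p+d<k) blue-1+p (forward p<k blue-p blue-1+p))
      where
      p<k : suc p ≤ k
      p<k = ≤-trans (s≤s (m≤m+n p d)) (subst (_≤ k) (+-suc p d) p+d<k)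

    sweep-down : ∀ {p} → p ≤ k → BlueAt S p → BlueAt S (suc p) → ∀ {q} → q ≤ p → BlueAt S q
    sweep-down {zero}  _   blue-0  _       z≤n = blue-0
    sweep-down {suc p} p<k blue-1+p blue-2+p q≤1+p with m≤n⇒m<n∨m≡n q≤1+p
    ... | inj₂ refl = blue-1+p
    ... | inj₁ q<1+p = sweep-down (<⇒≤ p<k) (backward (<⇒≤ p<k) blue-1+p blue-2+p) blue-1+p (s≤s⁻¹ q<1+p)

    path-blue : ∀ {p} → p ≤ k → BlueAt S p → BlueAt S (suc p) → ∀ {q} → q ≤ suc k → BlueAt S q
    path-blue {p} p≤k blue-p blue-1+p {q} q≤1+k with q ≤? p
    ... | yes q≤p = sweep-down p≤k blue-p blue-1+p q≤p
    ... | no  q≰p = subst (BlueAt S) (m+[n∸m]≡n p<q)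
                      (sweep-up (q ∸ suc p) (s≤s⁻¹ (subst (_≤ suc k) (sym (m+[n∸m]≡n p<q)) q≤1+k)) blue-p blue-1+p)
      where
      p<q : suc p ≤ q
      p<q = ≰⇒> q≰p

    path-blue⇒zeroForcing : (∀ {q} → q ≤ suc k → BlueAt S q) → IsZeroForcingSet tree S
    path-blue⇒zeroForcing on-path v = blue (toℕ v) (Fin.toℕ<n v) v refl
      where
      blue : ∀ w → w < n → BlueAt S w
      blue w w<n with path-or-leaf w | w ≟ J
      ... | inj₁ w≤1+k | _        = on-path w≤1+k
      ... | inj₂ leaf  | no  w≢J  = initialAt s w (leaves-in leaf w<n w≢J)
      ... | inj₂ leaf  | yes refl = forceAt z<s centre-blue (inj₂ (leaf↑centre leaf)) others
        where
        others : ∀ u → u < n → Edge 0 u → u ≢ w → BlueAt S u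
        others u u<n 0~u u≢J with centre-neighbour 0~u
        ... | inj₁ refl  = on-path (s≤s z≤n)
        ... | inj₂ leaf′ = initialAt s u (leaves-in leaf′ u<n u≢J)

    seed-1 : s 1 ≡ true → IsZeroForcingSet tree S
    seed-1 s1 = path-blue⇒zeroForcing (path-blue z≤n centre-blue (initialAt s 1 s1))

    seed-end : s (suc k) ≡ true → IsZeroForcingSet tree S
    seed-end s[1+k] = path-blue⇒zeroForcing (path-blue ≤-refl blue-k blue-1+k)
      where
      blue-1+k : BlueAt S (suc k)
      blue-1+k = initialAt s (suc k) s[1+k]
      blue-k : BlueAt S k
      blue-k = forceAt (path<n ≤-refl) blue-1+k (inj₁ (path↑ ≤-refl)) others
        where
        others : ∀ w → w < n → Edge (suc k) w → w ≢ k → BlueAt S w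
        others w _ e w≢k with path-neighbour z<s ≤-refl e
        ... | inj₁ w≡k          = contradiction w≡k w≢k
        ... | inj₂ (_ , 1+k≤k)  = contradiction 1+k≤k (<-irrefl refl)

    seed-pair : ∀ {i} → i ≤ k → s i ≡ true → s (suc i) ≡ true → IsZeroForcingSet tree S
    seed-pair i≤k si s[1+i] = path-blue⇒zeroForcing (path-blue i≤k (initialAt s _ si) (initialAt s _ s[1+i]))

    no-missing-leaf : (∀ {l} → Leaf l → l ≢ J) → IsZeroForcingSet tree S
    no-missing-leaf J-not-leaf = path-blue⇒zeroForcing (path-blue z≤n centre-blue blue-1)
      where
      blue-1 : BlueAt S 1
      blue-1 = forceAt z<s centre-blue (inj₂ (path↑ z≤n)) others
        where
        others : ∀ w → w < n → Edge 0 w → w ≢ 1 → BlueAt S w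
        others w w<n 0~w w≢1 with centre-neighbour 0~w
        ... | inj₁ w≡1 = contradiction w≡1 w≢1
        ... | inj₂ leaf = initialAt s w (leaves-in leaf w<n (J-not-leaf leaf))

  leaf? : ∀ w → Dec (Leaf w)
  leaf? w = 2 + k ≤? w

  inCandidate : ℕ → ℕ → ℕ → ℕ → Bool
  inCandidate J x y w = does ((leaf? w ×-dec ¬? (w ≟ J)) ⊎-dec (w ≟ x ⊎-dec w ≟ y))

  candidate : ℕ × ℕ × ℕ → Subset n
  candidate (J , x , y) = tab (inCandidate J x y)

  inCandidate-leaf : ∀ J x y {l} → Leaf l → l ≢ J → inCandidate J x y l ≡ true
  inCandidate-leaf J x y {l} leaf l≢J = dec-true ((leaf? l ×-dec ¬? (l ≟ J)) ⊎-dec (l ≟ x ⊎-dec l ≟ y)) (inj₁ (leaf , l≢J))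

  inCandidate-x : ∀ J x y → inCandidate J x y x ≡ true
  inCandidate-x J x y = dec-true ((leaf? x ×-dec ¬? (x ≟ J)) ⊎-dec (x ≟ x ⊎-dec x ≟ y)) (inj₂ (inj₁ refl))

  inCandidate-y : ∀ J x y → inCandidate J x y y ≡ true
  inCandidate-y J x y = dec-true ((leaf? y ×-dec ¬? (y ≟ J)) ⊎-dec (y ≟ x ⊎-dec y ≟ y)) (inj₂ (inj₂ refl))

  candidate-⊆ : ∀ {s J x y} → (∀ {l} → Leaf l → l < n → l ≢ J → s l ≡ true) → s x ≡ true → s y ≡ true →
    candidate (J , x , y) ⊆ tab s
  candidate-⊆ {s} {J} {x} {y} leaves-in sx sy {v} v∈
    with does⇒witness ((leaf? (toℕ v) ×-dec ¬? (toℕ v ≟ J)) ⊎-dec (toℕ v ≟ x ⊎-dec toℕ v ≟ y)) (∈-tab⁻ (inCandidate J x y) v v∈)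
  ... | inj₁ (leaf , v≢J) = ∈-tab⁺ s v (leaves-in leaf (Fin.toℕ<n v) v≢J)
  ... | inj₂ (inj₁ refl)  = ∈-tab⁺ s v sx
  ... | inj₂ (inj₂ refl)  = ∈-tab⁺ s v sy

  Candidate : Subset n → Set
  Candidate S = ∃ λ J → ∃ λ x → ∃ λ y → J < n × x < n × y < n × S ≡ candidate (J , x , y)

  minimal-⊇candidate : ∀ {s J x y} → IsMinimalZFS tree (tab s) → J < n → x < n → y < n →
    (∀ {l} → Leaf l → l < n → l ≢ J → s l ≡ true) → s x ≡ true → s y ≡ true →
    IsZeroForcingSet tree (candidate (J , x , y)) → Candidate (tab s)
  minimal-⊇candidate {J = J} {x} {y} minimal J<n x<n y<n leaves-in sx sy C-zfs =
    J , x , y , J<n , x<n , y<n , minimalZFS-⊇ZFS⇒≡ tree minimal C-zfs (candidate-⊆ leaves-in sx sy)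

  no-missing-leaf⇒candidate : ∀ s → IsMinimalZFS tree (tab s) → (∀ {l} → Leaf l → l < n → s l ≡ true) →
    Candidate (tab s)
  no-missing-leaf⇒candidate s minimal leaves-in =
    minimal-⊇candidate minimal z<s l<n l<n (λ leaf l<n _ → leaves-in leaf l<n) (leaves-in ≤-refl l<n) (leaves-in ≤-refl l<n)
      (AllLeavesBut.no-missing-leaf (inCandidate 0 l l) 0 (λ leaf _ → inCandidate-leaf 0 l l leaf) 0-not-leaf)
    where
    l = 2 + k
    l<n : l < n
    l<n = leaf<n (≤-trans (n≤1+n _) 3+k≤k+k)
    0-not-leaf : ∀ {w} → Leaf w → w ≢ 0
    0-not-leaf leaf refl = contradiction leaf λ ()

  other-leaves-in : ∀ s {J} → IsZeroForcingSet tree (tab s) → Leaf J → J < n → s J ≡ false →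
    ∀ {l} → Leaf l → l < n → l ≢ J → s l ≡ true
  other-leaves-in s zfs leaf-J J<n sJ leaf l<n l≢J = ¬-not λ sl →
    two-missing-leaves⇒¬zeroForcing leaf leaf-J l<n J<n l≢J
      (λ { v (inj₁ v≡l) → ∉-tab s v (trans (cong s v≡l) sl) ; v (inj₂ v≡J) → ∉-tab s v (trans (cong s v≡J) sJ) }) zfs

  missing-leaf⇒candidate : ∀ s {J} → IsMinimalZFS tree (tab s) → Leaf J → J < n → s J ≡ false → Candidate (tab s)
  missing-leaf⇒candidate s {J} minimal@(zfs , _) leaf-J J<n sJ = by-seed
    where
    conclude : ∀ {x y} → x < n → y < n → s x ≡ true → s y ≡ true →
      IsZeroForcingSet tree (candidate (J , x , y)) → Candidate (tab s)
    conclude x<n y<n = minimal-⊇candidate minimal J<n x<n y<n (other-leaves-in s zfs leaf-J J<n sJ)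
    module C x y = AllLeavesBut (inCandidate J x y) J (λ leaf _ → inCandidate-leaf J x y leaf)
    by-seed : Candidate (tab s)
    by-seed with s 1 Bool.≟ true
    ... | yes s1 = conclude (path<n (s≤s z≤n)) (path<n (s≤s z≤n)) s1 s1 (C.seed-1 1 1 (inCandidate-x J 1 1))
    ... | no ¬s1 with s (suc k) Bool.≟ true
    ...   | yes s[1+k] =
            conclude (path<n ≤-refl) (path<n ≤-refl) s[1+k] s[1+k] (C.seed-end (suc k) (suc k) (inCandidate-x J (suc k) (suc k)))
    ...   | no ¬s[1+k] with anyUpTo? (λ i → (0 <? i) ×-dec ((i ≤? k) ×-dec ((s i Bool.≟ true) ×-dec (s (suc i) Bool.≟ true)))) n
    ...     | yes (i , i<n , _ , i≤k , si , s[1+i]) =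
              conclude i<n (path<n (s≤s i≤k)) si s[1+i] (C.seed-pair i (suc i) i≤k (inCandidate-x J i (suc i)) (inCandidate-y J i (suc i)))
    ...     | no no-pair = contradiction zfs
              (no-seed⇒¬zeroForcing s leaf-J J<n sJ (¬-not ¬s1) (¬-not ¬s[1+k])
                 (λ {i} i>0 i≤k si → ¬-not λ s[1+i] → no-pair (i , path<n (≤-trans i≤k (n≤1+n k)) , i>0 , i≤k , si , s[1+i])))

  minimal⇒candidate : ∀ s → IsMinimalZFS tree (tab s) → Candidate (tab s)
  minimal⇒candidate s minimal with anyUpTo? (λ w → leaf? w ×-dec (s w Bool.≟ false)) n
  ... | no  none-missing            = no-missing-leaf⇒candidate s minimal λ leaf l<n → ¬-not λ sl → none-missing (_ , l<n , leaf , sl)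
  ... | yes (J , J<n , leaf-J , sJ) = missing-leaf⇒candidate s minimal leaf-J J<n sJ

  candidates : List (Subset n)
  candidates = map candidate (cartesianProduct (upTo n) (cartesianProduct (upTo n) (upTo n)))

  length-candidates : length candidates ≡ n ^ 3
  length-candidates = begin
    length candidates                                   ≡⟨ length-map candidate (cartesianProduct (upTo n) (cartesianProduct (upTo n) (upTo n))) ⟩
    length (cartesianProduct (upTo n) (cartesianProduct (upTo n) (upTo n)))
                                                        ≡⟨ length-cartesianProductWith _,_ (upTo n) (cartesianProduct (upTo n) (upTo n)) ⟩
    length (upTo n) * length (cartesianProduct (upTo n) (upTo n))
                                                        ≡⟨ cong₂ _*_ (length-upTo n) (length-cartesianProductWith _,_ (upTo n) (upTo n)) ⟩
    n * (length (upTo n) * length (upTo n))             ≡⟨ cong (λ l → n * (l * l)) (length-upTo n) ⟩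
    n * (n * n)                                         ≡⟨ cong (λ m → n * (n * m)) (*-identityʳ n) ⟨
    n ^ 3                                               ∎
    where open ≡-Reasoning

  minimal⇒∈candidates : ∀ {S} → IsMinimalZFS tree S → S ∈ₗ candidates
  minimal⇒∈candidates {S} minimal
    with minimal⇒candidate (χ S) (subst (IsMinimalZFS tree) (sym (tab-χ S)) minimal)
  ... | J , x , y , J<n , x<n , y<n , χS≡C =
    subst (_∈ₗ candidates) (trans (sym χS≡C) (tab-χ S))
      (∈-map⁺ candidate (∈-cartesianProduct⁺ (∈-upTo⁺ J<n) (∈-cartesianProduct⁺ (∈-upTo⁺ x<n) (∈-upTo⁺ y<n))))

  minimalZFSs-bound : (L : List (Subset n)) → Unique L → All (IsMinimalZFS tree) L → length L ≤ n ^ 3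
  minimalZFSs-bound L unique minimal = subst (length L ≤_) length-candidates
    (Unique-⊆⇒length≤ L candidates unique (minimal⇒∈candidates ∘ All.lookup minimal))

spider-broom-same-degrees : ∀ N v → degree (Spider.tree (2 + N)) v ≡ degree (Broom.tree (1 + N)) v
spider-broom-same-degrees N = childCount-≗⇒degree-≗ _ T.parent< T′.parent< same-children
  where
  module T  = Spider (2 + N)
  module T′ = Broom (1 + N)
  same-children : ∀ v → v < T.n → T.childCount v ≡ T′.childCount v
  same-children v v<n with T.vertex v<n
  ... | T.centre      = trans T.childCount-centre (sym T′.childCount-centre)
  ... | T.mid i>0 i≤k = trans (T.childCount-mid i>0 i≤k) (sym (T′.childCount-path i>0 i≤k))
  ... | T.tip i>0 i≤k = trans (T.childCount-tip i>0 i≤k) (sym (T′.childCount-beyond i>0))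

proposition2p3 : Σ ℕ λ p → Σ ℕ λ q → Σ ℕ λ C → Σ ℕ λ d → (0 < q) × (q < p) ×
    ((N : ℕ) → Σ ℕ λ n → Σ (Graph n) λ T → Σ (Graph n) λ T′ →
    (N ≤ n) × IsTree T × IsTree T′ ×
    (numLeaves T ≡ numLeaves T′) ×
    (numBranchpoints T ≡ numBranchpoints T′) ×
    (Σ (List (Subset n)) λ L → Unique L × All (IsMinimalZFS T) L ×
    (p ^ n ≤ length L * q ^ n)) ×
    ((L : List (Subset n)) → Unique L → All (IsMinimalZFS T′) L →
    length L ≤ C * n ^ d))
proposition2p3 = 9 , 8 , 1 , 3 , s≤s z≤n , ≤-refl , λ N →
  let module T  = Spider (2 + N)
      module T′ = Broom (1 + N)
  in T.n , T.tree , T′.tree ,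
     ≤-trans (m≤n+m N 4) (≤-trans (m≤m+n (4 + N) (4 + N)) (n≤1+n _)) ,
     T.isTree , T′.isTree ,
     numLeaves-cong {G = T.tree} {T′.tree} (spider-broom-same-degrees N) ,
     numBranchpoints-cong {G = T.tree} {T′.tree} (spider-broom-same-degrees N) ,
     (T.legSets , T.legSets-unique , T.legSets-minimal ,
      subst (λ l → 9 ^ T.n ≤ l * 8 ^ T.n) (sym T.length-legSets) (nine-eighths-bound N)) ,
     λ L unique minimal → subst (length L ≤_) (sym (*-identityˡ _)) (T′.minimalZFSs-bound L unique minimal)
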